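{- Let $e,f$ be two disjoint sequences of nonzero vectors in $\mathbb N^d$ with $|e|=|f|$, $\Delta_{e,f}\geq0$ on $[0,1]^d$ and $\Delta_{e,f}\geq1$ on $\mathcal D_{e,f}$, and let $p$ be a prime. Let $s\geq1$, $\mathbf a\in\{0,\dots,p^s-1\}^d$, $\mathbf m\in\mathbb N^d$ and $\mathbf L\in\mathcal E_{e,f}$. If $\lfloor\mathbf L\cdot\mathbf a/p^s\rfloor\geq1$, then for all $u\in\{1,\dots,\lfloor\mathbf L\cdot\mathbf a/p^s\rfloor\}$ and all $\ell\in\{s,\dots,s+v_p(\mathbf L\cdot\mathbf m+u)\}$ we have $\{(\mathbf a+\mathbf mp^s)/p^\ell\}\in\mathcal D_{e,f}$.
   Context: For $e=(\mathbf e_1,\dots,\mathbf e_{q_1})$, $f=(\mathbf f_1,\dots,\mathbf f_{q_2})$: $\Delta_{e,f}(\mathbf x)=\sum_i\lfloor\mathbf e_i\cdot\mathbf x\rfloor-\sum_j\lfloor\mathbf f_j\cdot\mathbf x\rfloor$; $\mathcal D_{e,f}$ is the set of $\mathbf x\in[0,1)^d$ with $\mathbf d\cdot\mathbf x\geq1$ for some $\mathbf d\in\{\mathbf e_1,\dots,\mathbf f_{q_2}\}$; $\mathcal E_{e,f}$ is the set of $\mathbf L\in\mathbb N^d\setminus\{\mathbf 0\}$ with $\mathbf L\leq\mathbf d$ coordinatewise for some such $\mathbf d$. $\{\cdot\}$ is the coordinatewise fractional part; $v_p$ is the $p$-adic valuation. -}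

module Defs where

open import Data.Nat as ℕ using (ℕ; zero; suc; _^_; NonZero)
open import Data.Nat.Properties using (m^n≢0)
open import Data.Nat.Primality using (Prime; prime⇒nonZero)
open import Data.Nat.Divisibility using (_∣_)
open import Data.Integer as ℤ using (ℤ; +_)
open import Data.Rational as ℚ using (ℚ; 0ℚ; 1ℚ; floor)
open import Data.Fin using (Fin; zero; suc)
open import Data.Product using (Σ; _×_; ∃)
open import Data.Sum using (_⊎_)
open import Relation.Nullary using (¬_)
open import Relation.Binary.PropositionalEquality using (_≡_)

∑ℕ : ∀ {n} → (Fin n → ℕ) → ℕ
∑ℕ {zero}  g = 0
∑ℕ {suc n} g = g zero ℕ.+ ∑ℕ (λ i → g (suc i))

∑ℤ : ∀ {n} → (Fin n → ℤ) → ℤ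
∑ℤ {zero}  g = + 0
∑ℤ {suc n} g = g zero ℤ.+ ∑ℤ (λ i → g (suc i))

∑ℚ : ∀ {n} → (Fin n → ℚ) → ℚ
∑ℚ {zero}  g = 0ℚ
∑ℚ {suc n} g = g zero ℚ.+ ∑ℚ (λ i → g (suc i))

Vecℕ : ℕ → Set
Vecℕ d = Fin d → ℕ

Vecℚ : ℕ → Set
Vecℚ d = Fin d → ℚ

ℕ→ℚ : ℕ → ℚ
ℕ→ℚ n = (+ n) ℚ./ 1

_·ℕ_ : ∀ {d} → Vecℕ d → Vecℕ d → ℕ
v ·ℕ w = ∑ℕ (λ k → v k ℕ.* w k)

_·ℚ_ : ∀ {d} → Vecℕ d → Vecℚ d → ℚ
v ·ℚ x = ∑ℚ (λ k → ℕ→ℚ (v k) ℚ.* x k)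

IsZeroVec : ∀ {d} → Vecℕ d → Set
IsZeroVec v = ∀ k → v k ≡ 0

Seq : ℕ → ℕ → Set
Seq d q = Fin q → Vecℕ d

∣_∣ : ∀ {d q} → Seq d q → Vecℕ d
∣ e ∣ k = ∑ℕ (λ i → e i k)

Disjoint : ∀ {d q₁ q₂} → Seq d q₁ → Seq d q₂ → Set
Disjoint e f = ∀ i j → ¬ (∀ k → e i k ≡ f j k)

Δ : ∀ {d q₁ q₂} → Seq d q₁ → Seq d q₂ → Vecℚ d → ℤ
Δ e f x = ∑ℤ (λ i → floor (e i ·ℚ x)) ℤ.- ∑ℤ (λ j → floor (f j ·ℚ x))

InClosedCube : ∀ {d} → Vecℚ d → Set
InClosedCube x = ∀ k → (0ℚ ℚ.≤ x k) × (x k ℚ.≤ 1ℚ)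

InHalfOpenCube : ∀ {d} → Vecℚ d → Set
InHalfOpenCube x = ∀ k → (0ℚ ℚ.≤ x k) × (x k ℚ.< 1ℚ)

IsOneOf : ∀ {d q₁ q₂} → Seq d q₁ → Seq d q₂ → Vecℕ d → Set
IsOneOf e f v = (Σ _ λ i → e i ≡ v) ⊎ (Σ _ λ j → f j ≡ v)

InD : ∀ {d q₁ q₂} → Seq d q₁ → Seq d q₂ → Vecℚ d → Set
InD e f x = InHalfOpenCube x × Σ _ (λ v → IsOneOf e f v × (1ℚ ℚ.≤ v ·ℚ x))

InE : ∀ {d q₁ q₂} → Seq d q₁ → Seq d q₂ → Vecℕ d → Set
InE e f L = ¬ IsZeroVec L × Σ _ (λ v → IsOneOf e f v × (∀ k → L k ℕ.≤ v k))

frac : ℚ → ℚ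
frac q = q ℚ.- ((floor q) ℚ./ 1)

divPow : ∀ {p} → Prime p → ℕ → ℕ → ℚ
divPow {p} pr n ℓ = (+ n) ℚ./ (p ^ ℓ)
  where instance
    _ = prime⇒nonZero pr
    _ = m^n≢0 p ℓ

floorDivPow : ∀ {p} → Prime p → ℕ → ℕ → ℕ
floorDivPow {p} pr n s = n ℕ./ (p ^ s)
  where instance
    _ = prime⇒nonZero pr
    _ = m^n≢0 p s

IsValuation : ℕ → ℕ → ℕ → Set
IsValuation p n v = (p ^ v ∣ n) × ¬ (p ^ suc v ∣ n)

-- Put P = p^s, T = p^(ℓ-s) and N = p^ℓ = T·P.  The k-th coordinate of the point
-- x = {(a + m P)/N} is r_k / N with r_k = (a_k + m_k P) mod N, so x ∈ [0,1)^d.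
-- Because a_k < P, the remainder is r_k = a_k + (m_k mod T)·P, hence
-- L·r = L·a + (L·(m mod T))·P.  Since ℓ - s ≤ v_p(L·m + u), T divides L·m + u and
-- therefore also the positive number L·(m mod T) + u, so T ≤ L·(m mod T) + u.
-- Multiplying by P and using u·P ≤ L·a (which is u ≤ ⌊L·a/P⌋) gives N ≤ L·r.
-- Finally, for the vector w of e or f dominating L, w·x ≥ L·x = (L·r)/N ≥ 1.

module Submission where

open import Defs
open import Data.Nat as ℕ using (ℕ; zero; suc; _+_; _*_; _^_; _≤_; _<_; NonZero)
import Data.Nat.Properties as ℕP
import Data.Nat.DivMod as ℕD
open import Data.Nat.Divisibility using (_∣_; divides; ∣m+n∣m⇒∣n; n∣m*n; ∣-trans; ∣⇒≤)
open import Data.Nat.Primality using (Prime; prime⇒nonZero)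
open import Data.Integer as ℤ using (ℤ; +_; +[1+_]; _≥_)
import Data.Integer.Properties as ℤP
import Data.Integer.DivMod as ℤD
open import Data.Rational as ℚ using (ℚ; mkℚ; toℚᵘ; floor; 0ℚ; 1ℚ)
open import Data.Rational.Unnormalised as ℚᵘ using (mkℚᵘ; *≤*; *<*; *≡*)
import Data.Rational.Properties as ℚP
import Data.Rational.Unnormalised.Properties as ℚᵘP
open import Data.Fin using (Fin; zero; suc)
open import Data.Product using (_×_; _,_; proj₁)
open import Relation.Nullary using (¬_)
open import Relation.Binary.PropositionalEquality
open import Data.Nat.Solver using (module +-*-Solver)
open import Data.Integer.Solver as ℤSolver using ()

toℚᵘ-/ : ∀ (i : ℤ) (N : ℕ) .{{_ : NonZero N}} → toℚᵘ (i ℚ./ N) ℚᵘ.≃ (i ℚᵘ./ N)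
toℚᵘ-/ i (suc K) = ℚP.toℚᵘ-fromℚᵘ (mkℚᵘ i K)

floor≡↥/↧ : ∀ y → floor y ≡ ℚ.↥ y ℤD./ℕ ℚ.↧ₙ y
floor≡↥/↧ (mkℚ a k _) = ℤD.div-pos-is-/ℕ a (suc k)

floor-≤ : ∀ y → mkℚᵘ (floor y) 0 ℚᵘ.≤ toℚᵘ y
floor-≤ (mkℚ a k c) rewrite floor≡↥/↧ (mkℚ a k c) =
  *≤* (subst (λ z → a ℤD./ℕ suc k ℤ.* +[1+ k ] ℤ.≤ z) (sym (ℤP.*-identityʳ a)) (ℤD.[n/ℕd]*d≤n a (suc k)))

<-floor+1 : ∀ y → toℚᵘ y ℚᵘ.< mkℚᵘ (ℤ.suc (floor y)) 0
<-floor+1 (mkℚ a k c) rewrite floor≡↥/↧ (mkℚ a k c) =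
  *<* (subst (ℤ._< ℤ.suc (a ℤD./ℕ suc k) ℤ.* +[1+ k ]) (sym (ℤP.*-identityʳ a)) (ℤD.n<s[n/ℕd]*d a (suc k)))

<-suc⇒≤ : ∀ {i j} → mkℚᵘ i 0 ℚᵘ.< mkℚᵘ (ℤ.suc j) 0 → i ℤ.≤ j
<-suc⇒≤ {i} {j} (*<* i<j+1) = subst (i ℤ.≤_) (ℤP.pred-suc j)
  (ℤP.i<j⇒i≤pred[j] (subst₂ ℤ._<_ (ℤP.*-identityʳ i) (ℤP.*-identityʳ (ℤ.suc j)) i<j+1))

floor-unique : ∀ y z → mkℚᵘ z 0 ℚᵘ.≤ toℚᵘ y → toℚᵘ y ℚᵘ.< mkℚᵘ (ℤ.suc z) 0 → floor y ≡ z
floor-unique y z z≤y y<z+1 = ℤP.≤-antisym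
  (<-suc⇒≤ (ℚᵘP.≤-<-trans (floor-≤ y) y<z+1))
  (<-suc⇒≤ (ℚᵘP.≤-<-trans z≤y (<-floor+1 y)))

floor-/ : ∀ n N .{{_ : NonZero N}} → floor ((+ n) ℚ./ N) ≡ + (n ℕ./ N)
floor-/ n N@(suc K) = floor-unique ((+ n) ℚ./ N) (+ q) q≤n/N n/N<q+1
  where
  q = n ℕ./ N
  q≤n/N : mkℚᵘ (+ q) 0 ℚᵘ.≤ toℚᵘ ((+ n) ℚ./ N)
  q≤n/N = ℚᵘP.≤-respʳ-≃ (ℚᵘP.≃-sym (toℚᵘ-/ (+ n) N))
    (*≤* (subst₂ ℤ._≤_ (ℤP.pos-* q N) (sym (ℤP.*-identityʳ (+ n))) (ℤ.+≤+ (ℕD.m/n*n≤m n N))))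
  n<[q+1]N : n < suc q * N
  n<[q+1]N = subst (_< suc q * N) (sym (ℕD.m≡m%n+[m/n]*n n N)) (ℕP.+-monoˡ-< (q * N) (ℕD.m%n<n n N))
  n/N<q+1 : toℚᵘ ((+ n) ℚ./ N) ℚᵘ.< mkℚᵘ (ℤ.suc (+ q)) 0
  n/N<q+1 = ℚᵘP.<-respˡ-≃ (ℚᵘP.≃-sym (toℚᵘ-/ (+ n) N))
    (*<* (subst₂ ℤ._<_ (sym (ℤP.*-identityʳ (+ n))) (ℤP.pos-* (suc q) N) (ℤ.+<+ n<[q+1]N)))

frac-toℚᵘ : ∀ y → toℚᵘ (frac y) ℚᵘ.≃ (toℚᵘ y ℚᵘ.- mkℚᵘ (floor y) 0)
frac-toℚᵘ y = ℚᵘP.≃-trans (ℚP.toℚᵘ-homo-+ y (ℚ.- (floor y ℚ./ 1)))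
  (ℚᵘP.+-congʳ (toℚᵘ y) (ℚᵘP.≃-trans (ℚP.toℚᵘ-homo‿- (floor y ℚ./ 1)) (ℚᵘP.-‿cong (toℚᵘ-/ (floor y) 1))))

frac-/ : ∀ n N .{{_ : NonZero N}} → frac ((+ n) ℚ./ N) ≡ (+ (n ℕ.% N)) ℚ./ N
frac-/ n N@(suc K) = ℚP.toℚᵘ-injective (begin
    toℚᵘ (frac y)                              ≈⟨ frac-toℚᵘ y ⟩
    toℚᵘ y ℚᵘ.- mkℚᵘ (floor y) 0                ≡⟨ cong (λ z → toℚᵘ y ℚᵘ.- mkℚᵘ z 0) (floor-/ n N) ⟩
    toℚᵘ y ℚᵘ.- mkℚᵘ (+ q) 0                    ≈⟨ ℚᵘP.+-congˡ (ℚᵘ.- mkℚᵘ (+ q) 0) (toℚᵘ-/ (+ n) N) ⟩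
    mkℚᵘ (+ n) K ℚᵘ.- mkℚᵘ (+ q) 0              ≈⟨ subtract-quotient ⟩
    mkℚᵘ (+ r) K                               ≈⟨ ℚᵘP.≃-sym (toℚᵘ-/ (+ r) N) ⟩
    toℚᵘ ((+ r) ℚ./ N)                         ∎)
  where
  open import Relation.Binary.Reasoning.Setoid ℚᵘP.≃-setoid
  open ℤSolver.+-*-Solver
  y = (+ n) ℚ./ N
  q = n ℕ./ N
  r = n ℕ.% N
  D = +[1+ K ]
  n≡r+qN : + n ≡ + r ℤ.+ + q ℤ.* D
  n≡r+qN = trans (cong +_ (ℕD.m≡m%n+[m/n]*n n N))
                 (trans (ℤP.pos-+ r (q * N)) (cong (λ z → + r ℤ.+ z) (ℤP.pos-* q N)))
  subtract-quotient : (mkℚᵘ (+ n) K ℚᵘ.- mkℚᵘ (+ q) 0) ℚᵘ.≃ mkℚᵘ (+ r) K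
  subtract-quotient = *≡* (trans (cong (λ z → (z ℤ.* + 1 ℤ.+ ℤ.- (+ q) ℤ.* D) ℤ.* D) n≡r+qN)
    (trans (solve 3 (λ R Q D → ((R :+ Q :* D) :* con (+ 1) :+ :- Q :* D) :* D := R :* D) refl (+ r) (+ q) D)
           (cong (λ z → + r ℤ.* +[1+ z ]) (sym (ℕP.*-identityʳ K)))))

proper-/-bounds : ∀ r N .{{_ : NonZero N}} → r < N → (0ℚ ℚ.≤ (+ r) ℚ./ N) × ((+ r) ℚ./ N ℚ.< 1ℚ)
proper-/-bounds r N@(suc K) r<N =
    ℚP.toℚᵘ-cancel-≤ (ℚᵘP.≤-respʳ-≃ (ℚᵘP.≃-sym (toℚᵘ-/ (+ r) N))
      (*≤* (subst₂ ℤ._≤_ (sym (ℤP.*-zeroˡ (+ N))) (sym (ℤP.*-identityʳ (+ r))) (ℤ.+≤+ ℕ.z≤n))))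
  , ℚP.toℚᵘ-cancel-< (ℚᵘP.<-respˡ-≃ (ℚᵘP.≃-sym (toℚᵘ-/ (+ r) N))
      (*<* (subst₂ ℤ._<_ (sym (ℤP.*-identityʳ (+ r))) (sym (ℤP.*-identityˡ (+ N))) (ℤ.+<+ r<N))))

1≤/ : ∀ M N .{{_ : NonZero N}} → N ≤ M → 1ℚ ℚ.≤ (+ M) ℚ./ N
1≤/ M N@(suc K) N≤M = ℚP.toℚᵘ-cancel-≤ (ℚᵘP.≤-respʳ-≃ (ℚᵘP.≃-sym (toℚᵘ-/ (+ M) N))
  (*≤* (subst₂ ℤ._≤_ (sym (ℤP.*-identityˡ (+ N))) (sym (ℤP.*-identityʳ (+ M))) (ℤ.+≤+ N≤M))))

ℕ→ℚ-mono : ∀ {a b} → a ≤ b → ℕ→ℚ a ℚ.≤ ℕ→ℚ b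
ℕ→ℚ-mono {a} {b} a≤b = ℚP.toℚᵘ-cancel-≤
  (ℚᵘP.≤-respʳ-≃ (ℚᵘP.≃-sym (toℚᵘ-/ (+ b) 1)) (ℚᵘP.≤-respˡ-≃ (ℚᵘP.≃-sym (toℚᵘ-/ (+ a) 1))
    (*≤* (subst₂ ℤ._≤_ (sym (ℤP.*-identityʳ (+ a))) (sym (ℤP.*-identityʳ (+ b))) (ℤ.+≤+ a≤b)))))

ℕ→ℚ-*-/ : ∀ a b N .{{_ : NonZero N}} → ℕ→ℚ a ℚ.* ((+ b) ℚ./ N) ≡ (+ (a * b)) ℚ./ N
ℕ→ℚ-*-/ a b N@(suc K) = ℚP.toℚᵘ-injective
  (ℚᵘP.≃-trans (ℚP.toℚᵘ-homo-* (ℕ→ℚ a) ((+ b) ℚ./ N))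
  (ℚᵘP.≃-trans (ℚᵘP.*-cong (toℚᵘ-/ (+ a) 1) (toℚᵘ-/ (+ b) N))
  (ℚᵘP.≃-trans product (ℚᵘP.≃-sym (toℚᵘ-/ (+ (a * b)) N)))))
  where
  product : (mkℚᵘ (+ a) 0 ℚᵘ.* mkℚᵘ (+ b) K) ℚᵘ.≃ mkℚᵘ (+ (a * b)) K
  product = *≡* (trans (cong (ℤ._* +[1+ K ]) (sym (ℤP.pos-* a b)))
                       (cong (λ z → + (a * b) ℤ.* +[1+ z ]) (sym (ℕP.+-identityʳ K))))

/-+-/ : ∀ a b N .{{_ : NonZero N}} → ((+ a) ℚ./ N) ℚ.+ ((+ b) ℚ./ N) ≡ (+ (a + b)) ℚ./ N
/-+-/ a b N@(suc K) = ℚP.toℚᵘ-injective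
  (ℚᵘP.≃-trans (ℚP.toℚᵘ-homo-+ ((+ a) ℚ./ N) ((+ b) ℚ./ N))
  (ℚᵘP.≃-trans (ℚᵘP.+-cong (toℚᵘ-/ (+ a) N) (toℚᵘ-/ (+ b) N))
  (ℚᵘP.≃-trans sum (ℚᵘP.≃-sym (toℚᵘ-/ (+ (a + b)) N)))))
  where
  open ℤSolver.+-*-Solver
  D = +[1+ K ]
  sum : (mkℚᵘ (+ a) K ℚᵘ.+ mkℚᵘ (+ b) K) ℚᵘ.≃ mkℚᵘ (+ (a + b)) K
  sum = *≡* (trans (solve 3 (λ A B D → (A :* D :+ B :* D) :* D := (A :+ B) :* (D :* D)) refl (+ a) (+ b) D)
                   (sym (cong₂ ℤ._*_ (ℤP.pos-+ a b) (ℤP.pos-* N N))))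

∑ℕ-cong : ∀ {d} {g h : Fin d → ℕ} → (∀ k → g k ≡ h k) → ∑ℕ g ≡ ∑ℕ h
∑ℕ-cong {zero}  g≡h = refl
∑ℕ-cong {suc d} g≡h = cong₂ _+_ (g≡h zero) (∑ℕ-cong (λ k → g≡h (suc k)))

∑ℕ-+ : ∀ {d} (g h : Fin d → ℕ) → ∑ℕ (λ k → g k + h k) ≡ ∑ℕ g + ∑ℕ h
∑ℕ-+ {zero}  g h = refl
∑ℕ-+ {suc d} g h = trans (cong (_+_ (g zero + h zero)) (∑ℕ-+ (λ k → g (suc k)) (λ k → h (suc k))))
  (interchange (g zero) (h zero) (∑ℕ (λ k → g (suc k))) (∑ℕ (λ k → h (suc k))))
  where
  open +-*-Solver
  interchange : ∀ a b c d → a + b + (c + d) ≡ a + c + (b + d)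
  interchange = solve 4 (λ a b c d → a :+ b :+ (c :+ d) := a :+ c :+ (b :+ d)) refl

∑ℕ-*ʳ : ∀ {d} (g : Fin d → ℕ) c → ∑ℕ (λ k → g k * c) ≡ ∑ℕ g * c
∑ℕ-*ʳ {zero}  g c = refl
∑ℕ-*ʳ {suc d} g c = trans (cong (_+_ (g zero * c)) (∑ℕ-*ʳ (λ k → g (suc k)) c))
  (sym (ℕP.*-distribʳ-+ c (g zero) (∑ℕ (λ k → g (suc k)))))

·ℕ-digits : ∀ {d} (L a w : Vecℕ d) P → L ·ℕ (λ k → a k + w k * P) ≡ L ·ℕ a + (L ·ℕ w) * P
·ℕ-digits L a w P = begin
  L ·ℕ (λ k → a k + w k * P)                         ≡⟨ ∑ℕ-cong (λ k → distrib (L k) (a k) (w k)) ⟩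
  ∑ℕ (λ k → L k * a k + L k * w k * P)              ≡⟨ ∑ℕ-+ (λ k → L k * a k) (λ k → L k * w k * P) ⟩
  L ·ℕ a + ∑ℕ (λ k → L k * w k * P)                 ≡⟨ cong (_+_ (L ·ℕ a)) (∑ℕ-*ʳ (λ k → L k * w k) P) ⟩
  L ·ℕ a + (L ·ℕ w) * P                              ∎
  where
  open ≡-Reasoning
  open +-*-Solver
  distrib : ∀ l x y → l * (x + y * P) ≡ l * x + l * y * P
  distrib l x y = solve 4 (λ l x y P → l :* (x :+ y :* P) := l :* x :+ l :* y :* P) refl l x y P

∑ℚ-cong : ∀ {d} {g h : Fin d → ℚ} → (∀ k → g k ≡ h k) → ∑ℚ g ≡ ∑ℚ h
∑ℚ-cong {zero}  g≡h = refl
∑ℚ-cong {suc d} g≡h = cong₂ ℚ._+_ (g≡h zero) (∑ℚ-cong (λ k → g≡h (suc k)))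

∑ℚ-mono : ∀ {d} {g h : Fin d → ℚ} → (∀ k → g k ℚ.≤ h k) → ∑ℚ g ℚ.≤ ∑ℚ h
∑ℚ-mono {zero}  g≤h = ℚP.≤-refl
∑ℚ-mono {suc d} g≤h = ℚP.+-mono-≤ (g≤h zero) (∑ℚ-mono (λ k → g≤h (suc k)))

·ℚ-/ : ∀ {d} (L r : Vecℕ d) N .{{_ : NonZero N}} → L ·ℚ (λ k → (+ r k) ℚ./ N) ≡ (+ (L ·ℕ r)) ℚ./ N
·ℚ-/ {zero}  L r N = sym (ℚP.0/n≡0 N)
·ℚ-/ {suc d} L r N = trans
  (cong₂ ℚ._+_ (ℕ→ℚ-*-/ (L zero) (r zero) N) (·ℚ-/ (λ k → L (suc k)) (λ k → r (suc k)) N))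
  (/-+-/ (L zero * r zero) ((λ k → L (suc k)) ·ℕ (λ k → r (suc k))) N)

·ℚ-monoˡ : ∀ {d} {L w : Vecℕ d} (x : Vecℚ d) → (∀ k → 0ℚ ℚ.≤ x k) → (∀ k → L k ≤ w k) → L ·ℚ x ℚ.≤ w ·ℚ x
·ℚ-monoˡ x 0≤x L≤w = ∑ℚ-mono (λ k →
  ℚP.*-monoʳ-≤-nonNeg (x k) {{ℚ.nonNegative (0≤x k)}} (ℕ→ℚ-mono (L≤w k)))

^-monoʳ-∣ : ∀ p {i j} → i ≤ j → p ^ i ∣ p ^ j
^-monoʳ-∣ p {i} {j} i≤j = divides (p ^ (j ℕ.∸ i))
  (trans (cong (p ^_) (sym (ℕP.m∸n+n≡m i≤j))) (ℕP.^-distribˡ-+-* p (j ℕ.∸ i) i))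

-- Replacing m by m mod T changes L·m by a multiple of T, so divisibility of
-- L·m + u by T is preserved.
∣-·ℕ-mod : ∀ {d} (L m : Vecℕ d) T .{{_ : NonZero T}} u → T ∣ L ·ℕ m + u → T ∣ L ·ℕ (λ k → m k ℕ.% T) + u
∣-·ℕ-mod L m T u T∣Lm+u = ∣m+n∣m⇒∣n (subst (T ∣_) Lm+u≡ T∣Lm+u) (n∣m*n (L ·ℕ q))
  where
  w q : Vecℕ _
  w k = m k ℕ.% T
  q k = m k ℕ./ T
  Lm≡ : L ·ℕ m ≡ L ·ℕ w + (L ·ℕ q) * T
  Lm≡ = trans (∑ℕ-cong (λ k → cong (_*_ (L k)) (ℕD.m≡m%n+[m/n]*n (m k) T))) (·ℕ-digits L w q T)
  Lm+u≡ : L ·ℕ m + u ≡ (L ·ℕ q) * T + (L ·ℕ w + u)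
  Lm+u≡ = trans (cong (_+ u) Lm≡) (solve 3 (λ A B C → A :+ B :+ C := B :+ (A :+ C)) refl (L ·ℕ w) _ u)
    where open +-*-Solver

-- In base P the number a + m P (a < P) has last digit a and upper part m;
-- reducing modulo T P reduces only the upper part: (a + m P) mod T P = a + (m mod T) P.
mod-digits : ∀ a m P T .{{_ : NonZero T}} .{{_ : NonZero (T * P)}} → a < P →
             (a + m * P) ℕ.% (T * P) ≡ a + m ℕ.% T * P
mod-digits a m P T a<P = begin
  (a + m * P) ℕ.% (T * P)       ≡⟨ cong (ℕ._% (T * P)) (ℕP.+-comm a (m * P)) ⟩
  (m * P + a) ℕ.% (T * P)       ≡⟨ ℕD.[m*n+o]%[p*n]≡[m*n]%[p*n]+o m T a<P ⟩
  (m * P) ℕ.% (T * P) + a       ≡⟨ cong (_+ a) (ℕD.m%n*o≡m*o%[n*o] m T P) ⟨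
  m ℕ.% T * P + a               ≡⟨ ℕP.+-comm (m ℕ.% T * P) a ⟩
  a + m ℕ.% T * P               ∎
  where open ≡-Reasoning

carry-bound : ∀ {d} (L a m : Vecℕ d) P T N .{{_ : NonZero P}} .{{_ : NonZero T}} .{{_ : NonZero N}} u →
              N ≡ T * P → (∀ k → a k < P) → 1 ≤ u → u * P ≤ L ·ℕ a → T ∣ L ·ℕ m + u →
              N ≤ L ·ℕ (λ k → (a k + m k * P) ℕ.% N)
carry-bound L a m P T N u N≡TP a<P 1≤u uP≤La T∣Lm+u = begin
  N                          ≡⟨ N≡TP ⟩
  T * P                      ≤⟨ ℕP.*-monoˡ-≤ P T≤Lw+u ⟩
  (L ·ℕ w + u) * P           ≡⟨ ℕP.*-distribʳ-+ P (L ·ℕ w) u ⟩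
  L ·ℕ w * P + u * P         ≤⟨ ℕP.+-monoʳ-≤ (L ·ℕ w * P) uP≤La ⟩
  L ·ℕ w * P + L ·ℕ a        ≡⟨ ℕP.+-comm (L ·ℕ w * P) (L ·ℕ a) ⟩
  L ·ℕ a + L ·ℕ w * P        ≡⟨ ·ℕ-digits L a w P ⟨
  L ·ℕ (λ k → a k + w k * P) ≡⟨ ∑ℕ-cong (λ k → cong (_*_ (L k)) (remainder k)) ⟨
  L ·ℕ (λ k → (a k + m k * P) ℕ.% N) ∎
  where
  open ℕP.≤-Reasoning
  w : Vecℕ _
  w k = m k ℕ.% T
  instance
    TP≢0 : NonZero (T * P)
    TP≢0 = ℕP.m*n≢0 T P
  remainder : ∀ k → (a k + m k * P) ℕ.% N ≡ a k + w k * P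
  remainder k = trans (ℕD.%-congʳ N≡TP) (mod-digits (a k) (m k) P T (a<P k))
  T≤Lw+u : T ≤ L ·ℕ w + u
  T≤Lw+u = ∣⇒≤ {{ℕ.>-nonZero (ℕP.<-≤-trans (ℕP.m≤n+m 1 (L ·ℕ w)) (ℕP.+-monoʳ-≤ (L ·ℕ w) 1≤u))}}
                (∣-·ℕ-mod L m T u T∣Lm+u)

lemma10 : ∀ {d q₁ q₂} (e : Seq d q₁) (f : Seq d q₂) →
          (∀ i → ¬ IsZeroVec (e i)) → (∀ j → ¬ IsZeroVec (f j)) →
          Disjoint e f →
          (∀ k → ∣ e ∣ k ≡ ∣ f ∣ k) →
          (∀ x → InClosedCube x → Δ e f x ≥ + 0) →
          (∀ x → InD e f x → Δ e f x ≥ + 1) →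
          ∀ {p} (pr : Prime p) (s : ℕ) → 1 ≤ s →
          (a : Vecℕ d) → (∀ k → a k < p ^ s) →
          (m : Vecℕ d) → (L : Vecℕ d) → InE e f L →
          1 ≤ floorDivPow pr (L ·ℕ a) s →
          ∀ (u : ℕ) → 1 ≤ u → u ≤ floorDivPow pr (L ·ℕ a) s →
          ∀ (v : ℕ) → IsValuation p (L ·ℕ m + u) v →
          ∀ (ℓ : ℕ) → s ≤ ℓ → ℓ ≤ s + v →
          InD e f (λ k → frac (divPow pr (a k + m k * p ^ s) ℓ))
lemma10 e f _ _ _ _ _ _ {p} pr s _ a a<P m L (_ , w , w∈ef , L≤w) _ u 1≤u u≤La/P v (pᵛ∣ , _) ℓ s≤ℓ ℓ≤s+v =
  x∈cube , w , w∈ef , 1≤w·x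
  where
  P T N : ℕ
  P = p ^ s
  T = p ^ (ℓ ℕ.∸ s)
  N = p ^ ℓ
  instance
    p≢0 : NonZero p
    p≢0 = prime⇒nonZero pr
    P≢0 : NonZero P
    P≢0 = ℕP.m^n≢0 p s
    T≢0 : NonZero T
    T≢0 = ℕP.m^n≢0 p (ℓ ℕ.∸ s)
    N≢0 : NonZero N
    N≢0 = ℕP.m^n≢0 p ℓ
  r : Vecℕ _
  r k = (a k + m k * P) ℕ.% N
  x : Vecℚ _
  x k = frac (divPow pr (a k + m k * P) ℓ)
  x≡r/N : ∀ k → x k ≡ (+ r k) ℚ./ N
  x≡r/N k = frac-/ (a k + m k * P) N
  x∈cube : InHalfOpenCube x
  x∈cube k rewrite x≡r/N k = proper-/-bounds (r k) N (ℕD.m%n<n _ N)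
  N≡TP : N ≡ T * P
  N≡TP = trans (cong (p ^_) (sym (ℕP.m∸n+n≡m s≤ℓ))) (ℕP.^-distribˡ-+-* p (ℓ ℕ.∸ s) s)
  T∣pᵛ : T ∣ p ^ v
  T∣pᵛ = ^-monoʳ-∣ p (ℕP.≤-trans (ℕP.∸-monoˡ-≤ s ℓ≤s+v) (ℕP.≤-reflexive (ℕP.m+n∸m≡n s v)))
  N≤L·r : N ≤ L ·ℕ r
  N≤L·r = carry-bound L a m P T N u N≡TP a<P 1≤u
    (ℕP.≤-trans (ℕP.*-monoˡ-≤ P u≤La/P) (ℕD.m/n*n≤m (L ·ℕ a) P)) (∣-trans T∣pᵛ pᵛ∣)
  1≤w·x : 1ℚ ℚ.≤ w ·ℚ x
  1≤w·x = begin
    1ℚ                          ≤⟨ 1≤/ (L ·ℕ r) N N≤L·r ⟩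
    (+ (L ·ℕ r)) ℚ./ N          ≡⟨ ·ℚ-/ L r N ⟨
    L ·ℚ (λ k → (+ r k) ℚ./ N)  ≡⟨ ∑ℚ-cong (λ k → cong (λ z → ℕ→ℚ (L k) ℚ.* z) (x≡r/N k)) ⟨
    L ·ℚ x                      ≤⟨ ·ℚ-monoˡ x (λ k → proj₁ (x∈cube k)) L≤w ⟩
    w ·ℚ x                      ∎
    where open ℚP.≤-Reasoning
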